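{- A graph $G$ is isomorphic to a letter graph $G(\mathcal{P},w)$ for the alphabet $\{a,b,c\}$, the decoder $\mathcal{P}=\{(a,b),(b,c),(c,a)\}$ and some word $w$ over $\{a,b,c\}$ if and only if $G$ is nice, i.e. iff $V(G)$ can be partitioned into three independent sets $A,B,C$ such that (a) $G[A\cup B]$, $G[B\cup C]$ and $G[C\cup A]$ are $2K_2$-free bipartite graphs, and (b) there are no three vertices $a\in A$, $b\in B$, $c\in C$ inducing either a triangle or an independent set of size 3.
   Context: For a finite alphabet $\Sigma$, a decoder $\mathcal{P}\subseteq\Sigma^2$ (set of ordered pairs) and a word $w=w_1\cdots w_n$ over $\Sigma$, the letter graph $G(\mathcal{P},w)$ has vertex set $\{1,\dots,n\}$, with $i<j$ adjacent iff $(w_i,w_j)\in\mathcal{P}$. Independent sets in the partition are allowed to be empty. -}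

module Defs where

open import Data.Bool using (Bool; true; false)
open import Data.Nat using (ℕ)
open import Data.Nat.Properties using (<-cmp)
open import Data.Fin using (Fin; toℕ)
open import Data.Vec using (Vec; lookup)
open import Data.Product using (Σ; _×_; _,_; ∃-syntax)
open import Data.Sum using (_⊎_)
open import Relation.Binary using (Tri; tri<; tri≈; tri>)
open import Relation.Binary.PropositionalEquality using (_≡_; _≢_; refl; sym)
open import Relation.Nullary using (¬_)
open import Data.Empty using (⊥-elim)
open import Function.Bundles using (_↔_; Inverse)

record Graph (n : ℕ) : Set where
  field
    adj    : Fin n → Fin n → Bool
    adj-sym : ∀ u v → adj u v ≡ adj v u
    adj-irr : ∀ v → adj v v ≡ false
open Graph public

_≅_ : ∀ {m n} → Graph m → Graph n → Set
_≅_ {m} {n} G H =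
  Σ (Fin m ↔ Fin n) λ f → ∀ u v → adj G u v ≡ adj H (Inverse.to f u) (Inverse.to f v)

Decoder : Set → Set
Decoder Σ' = Σ' → Σ' → Bool

letterAdj : ∀ {Σ' : Set} {n} → Decoder Σ' → Vec Σ' n → Fin n → Fin n → Bool
letterAdj {n = n} P w i j with <-cmp (toℕ i) (toℕ j)
... | tri< _ _ _ = P (lookup w i) (lookup w j)
... | tri≈ _ _ _ = false
... | tri> _ _ _ = P (lookup w j) (lookup w i)

private
  lsym : ∀ {Σ' : Set} {n} (P : Decoder Σ') (w : Vec Σ' n) i j →
         letterAdj P w i j ≡ letterAdj P w j i
  lsym P w i j with <-cmp (toℕ i) (toℕ j) | <-cmp (toℕ j) (toℕ i)
  ... | tri< p _ _ | tri< _ _ c = ⊥-elim (c p)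
  ... | tri< p _ _ | tri≈ _ _ c = ⊥-elim (c p)
  ... | tri< _ _ _ | tri> _ _ _ = refl
  ... | tri≈ _ _ _ | tri≈ _ _ _ = refl
  ... | tri≈ _ e _ | tri< _ e' _ = ⊥-elim (e' (sym e))
  ... | tri≈ _ e _ | tri> _ e' _ = ⊥-elim (e' (sym e))
  ... | tri> _ _ _ | tri< _ _ _ = refl
  ... | tri> _ _ p | tri≈ a' _ _ = ⊥-elim (a' p)
  ... | tri> _ _ p | tri> a' _ _ = ⊥-elim (a' p)

  lirr : ∀ {Σ' : Set} {n} (P : Decoder Σ') (w : Vec Σ' n) i → letterAdj P w i i ≡ false
  lirr P w i with <-cmp (toℕ i) (toℕ i)
  ... | tri< _ e _ = ⊥-elim (e refl)
  ... | tri≈ _ _ _ = refl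
  ... | tri> _ e _ = ⊥-elim (e refl)

letterGraph : ∀ {Σ' : Set} {n} → Decoder Σ' → Vec Σ' n → Graph n
letterGraph P w = record { adj = letterAdj P w ; adj-sym = lsym P w ; adj-irr = lirr P w }

data Letter : Set where
  a b c : Letter

cyclicP : Decoder Letter
cyclicP a b = true
cyclicP b c = true
cyclicP c a = true
cyclicP _ _ = false

module _ {n : ℕ} (G : Graph n) where

  InducedBipartite : (Fin n → Set) → Set
  InducedBipartite S = Σ (Fin n → Bool) λ col →
    ∀ u v → S u → S v → adj G u v ≡ true → col u ≢ col v

  Induced2K2Free : (Fin n → Set) → Set
  Induced2K2Free S = ∀ u₁ v₁ u₂ v₂ → S u₁ → S v₁ → S u₂ → S v₂ →
    ¬ ( adj G u₁ v₁ ≡ true × adj G u₂ v₂ ≡ true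
      × adj G u₁ u₂ ≡ false × adj G u₁ v₂ ≡ false
      × adj G v₁ u₂ ≡ false × adj G v₁ v₂ ≡ false )

  Independent : (Fin n → Set) → Set
  Independent S = ∀ u v → S u → S v → adj G u v ≡ false

  -- G is nice: V(G) = A ⊔ B ⊔ C (parts may be empty), given by a labelling part : V → {a,b,c}.
  _∪_ : (Fin n → Set) → (Fin n → Set) → Fin n → Set
  (S ∪ T) v = S v ⊎ T v

  Class : (Fin n → Letter) → Letter → Fin n → Set
  Class part ℓ v = part v ≡ ℓ

  record NicePartition (part : Fin n → Letter) : Set where
    field
      indA : Independent (Class part a)
      indB : Independent (Class part b)
      indC : Independent (Class part c)
      bipAB : InducedBipartite ((Class part a) ∪ (Class part b))
      bipBC : InducedBipartite ((Class part b) ∪ (Class part c))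
      bipCA : InducedBipartite ((Class part c) ∪ (Class part a))
      freeAB : Induced2K2Free ((Class part a) ∪ (Class part b))
      freeBC : Induced2K2Free ((Class part b) ∪ (Class part c))
      freeCA : Induced2K2Free ((Class part c) ∪ (Class part a))
      noTriangle : ∀ x y z → (Class part a) x → (Class part b) y → (Class part c) z →
        ¬ (adj G x y ≡ true × adj G y z ≡ true × adj G x z ≡ true)
      noIndep3 : ∀ x y z → (Class part a) x → (Class part b) y → (Class part c) z →
        ¬ (adj G x y ≡ false × adj G y z ≡ false × adj G x z ≡ false)

  Nice : Set
  Nice = Σ (Fin n → Letter) NicePartition

-- The bridge between the two sides is the notion of a LAYOUT of G for a decoder P: a letter for
-- every vertex together with an injective placement of the vertices in ℕ such that whenever u is
-- placed before v, u and v are adjacent exactly when (letter u, letter v) ∈ P.  The proof is: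
--
--   (1) for every decoder, G is isomorphic to a letter graph iff G has a layout
--       (a layout is a word read in placement order; ranking the placements gives the word);
--   (2) a layout for the cyclic decoder makes its letter classes a nice partition
--       (every condition of niceness would force a cycle in the placement order);
--   (3) conversely, a nice partition has a layout: between vertices of distinct classes the
--       adjacency FORCES which one comes first, and niceness excludes the two kinds of short
--       forced cycles (rainbow triangles, alternating squares between two classes).  This makes
--       "forced in at most two steps" a strict partial order, and counting the vertices below a
--       vertex, with ties broken by the vertex index, gives the placement.
module Submission where

open import Defs
open import Data.Bool using (Bool; true; false; not)
open import Data.Bool.Properties using (¬-not; not-¬) renaming (_≟_ to _≟ᵇ_)
open import Data.Empty using (⊥; ⊥-elim)
open import Data.Fin using (Fin; toℕ; fromℕ<; punchOut)
open import Data.Fin.Properties using (toℕ-injective; toℕ-fromℕ<; toℕ<n; punchOut-injective; <⇒notInjective; any?)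
  renaming (_≟_ to _≟ᶠ_)
open import Data.Fin.Subset using (Subset; _∈_; _⊂_; ⊤; ∣_∣)
open import Data.Fin.Subset.Properties using (p⊂q⇒∣p∣<∣q∣; ∣⊤∣≡n; ∈⊤)
open import Data.Nat using (ℕ; suc; _+_; _*_; _<_)
open import Data.Nat.Properties using (<-cmp; <-irrefl; <-asym; <-trans; _<?_; +-cancelˡ-≡; +-monoʳ-<; *-monoˡ-≤; m≤m+n; +-comm; ≤-trans; ≤-reflexive; <-≤-trans; n<1+n)
open import Data.Product using (Σ; ∃; _×_; _,_; proj₁; proj₂)
open import Data.Sum using (_⊎_; inj₁; inj₂; [_,_]; swap)
open import Data.Vec using (Vec; lookup; tabulate)
open import Data.Vec.Properties using (lookup∘tabulate; lookup⇒[]=; []=⇒lookup)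
open import Function using (_∘_)
open import Function.Bundles using (_⇔_; _↔_; Inverse; Injection; mk⇔; mk↔ₛ′)
open import Function.Properties.Inverse using (↔⇒↣)
open import Relation.Binary using (tri<; tri≈; tri>)
open import Relation.Binary.PropositionalEquality using (_≡_; _≢_; refl; sym; trans; cong; cong₂; subst; subst₂; module ≡-Reasoning)
open import Relation.Nullary using (¬_; Dec; yes; no; does; contradiction; ¬?; _×-dec_; _⊎-dec_)
open import Relation.Nullary.Decidable using (dec-true)

witness : {A : Set} (d : Dec A) → does d ≡ true → A
witness (yes p) _ = p

data Order {A : Set} (key : A → ℕ) (u v : A) : Set where
  before : key u < key v → Order key u v
  same   : u ≡ v → Order key u v
  after  : key v < key u → Order key u v

order : {A : Set} (key : A → ℕ) → (∀ {u v} → key u ≡ key v → u ≡ v) → ∀ u v → Order key u v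
order key key-injective u v with <-cmp (key u) (key v)
... | tri< lt _ _ = before lt
... | tri≈ _ eq _ = same (key-injective eq)
... | tri> _ _ gt = after gt

selection : ∀ {m} {P : Fin m → Set} → (∀ x → Dec (P x)) → Subset m
selection P? = tabulate (λ x → does (P? x))

∈-selection⁺ : ∀ {m} {P : Fin m → Set} (P? : ∀ x → Dec (P x)) {x : Fin m} → P x → x ∈ selection P?
∈-selection⁺ P? {x} px = lookup⇒[]= x _ (trans (lookup∘tabulate _ x) (dec-true (P? x) px))

∈-selection⁻ : ∀ {m} {P : Fin m → Set} (P? : ∀ x → Dec (P x)) {x : Fin m} → x ∈ selection P? → P x
∈-selection⁻ P? {x} x∈ = witness (P? x) (trans (sym (lookup∘tabulate _ x)) ([]=⇒lookup x∈))

module Height {m} {_≺_ : Fin m → Fin m → Set} (_≺?_ : ∀ x y → Dec (x ≺ y))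
              (≺-irrefl : ∀ x → ¬ x ≺ x) (≺-trans : ∀ {x y z} → x ≺ y → y ≺ z → x ≺ z) where

  below : Fin m → Subset m
  below v = selection (_≺? v)

  height : Fin m → ℕ
  height v = ∣ below v ∣

  height-mono : ∀ {u v} → u ≺ v → height u < height v
  height-mono {u} {v} u≺v = p⊂q⇒∣p∣<∣q∣
    ( (λ x∈ → ∈-selection⁺ (_≺? v) (≺-trans (∈-selection⁻ (_≺? u) x∈) u≺v))
    , u , ∈-selection⁺ (_≺? v) u≺v , ≺-irrefl u ∘ ∈-selection⁻ (_≺? u) )

  height<size : ∀ v → height v < m
  height<size v = subst (height v <_) (∣⊤∣≡n m)
    (p⊂q⇒∣p∣<∣q∣ ((λ _ → ∈⊤) , v , ∈⊤ , ≺-irrefl v ∘ ∈-selection⁻ (_≺? v)))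

injective⇒surjective : ∀ {n} (f : Fin n → Fin n) → (∀ {x y} → f x ≡ f y → x ≡ y) →
                       ∀ j → ∃ λ i → f i ≡ j
injective⇒surjective {suc k} f f-injective j with any? (λ i → f i ≟ᶠ j)
... | yes hit = hit
... | no miss = ⊥-elim (<⇒notInjective (n<1+n k) squeeze-injective)
  where
  squeeze : Fin (suc k) → Fin k
  squeeze i = punchOut (λ e → miss (i , sym e))
  squeeze-injective : ∀ {x y} → squeeze x ≡ squeeze y → x ≡ y
  squeeze-injective {x} {y} e =
    f-injective (punchOut-injective (λ e → miss (x , sym e)) (λ e → miss (y , sym e)) e)

module Ranking {m} (key : Fin m → ℕ) (key-injective : ∀ {u v} → key u ≡ key v → u ≡ v) where
  open Height {_≺_ = λ u v → key u < key v} (λ u v → key u <? key v) (λ _ → <-irrefl refl) <-trans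

  rank : Fin m → Fin m
  rank v = fromℕ< (height<size v)

  rank-mono : ∀ {u v} → key u < key v → toℕ (rank u) < toℕ (rank v)
  rank-mono {u} {v} lt =
    subst₂ _<_ (sym (toℕ-fromℕ< (height<size u))) (sym (toℕ-fromℕ< (height<size v))) (height-mono lt)

  rank-injective : ∀ {u v} → rank u ≡ rank v → u ≡ v
  rank-injective {u} {v} e with order key key-injective u v
  ... | before lt = contradiction (cong toℕ e) (λ eq → <-irrefl eq (rank-mono lt))
  ... | same u≡v  = u≡v
  ... | after gt  = contradiction (cong toℕ e) (λ eq → <-irrefl (sym eq) (rank-mono gt))

  unrank : Fin m → Fin m
  unrank j = proj₁ (injective⇒surjective rank rank-injective j)

  rank-unrank : ∀ j → rank (unrank j) ≡ j
  rank-unrank j = proj₂ (injective⇒surjective rank rank-injective j)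

  unrank-rank : ∀ v → unrank (rank v) ≡ v
  unrank-rank v = rank-injective (rank-unrank (rank v))

  ranking : Fin m ↔ Fin m
  ranking = mk↔ₛ′ rank unrank rank-unrank unrank-rank

module TieBreak {m} (h : Fin m → ℕ) where

  key : Fin m → ℕ
  key v = h v * m + toℕ v

  key-mono : ∀ {u v} → h u < h v → key u < key v
  -- key u < h u * m + m ≤ h v * m ≤ key v
  key-mono {u} {v} lt =
    <-≤-trans (+-monoʳ-< (h u * m) (toℕ<n u))
      (≤-trans (≤-reflexive (+-comm (h u * m) m))
        (≤-trans (*-monoˡ-≤ m lt) (m≤m+n (h v * m) (toℕ v))))

  key-injective : ∀ {u v} → key u ≡ key v → u ≡ v
  key-injective {u} {v} e with <-cmp (h u) (h v)
  ... | tri< lt _ _ = contradiction e (λ eq → <-irrefl eq (key-mono lt))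
  ... | tri> _ _ gt = contradiction (sym e) (λ eq → <-irrefl eq (key-mono gt))
  ... | tri≈ _ eq _ = toℕ-injective (+-cancelˡ-≡ (h u * m) (toℕ u) (toℕ v)
                        (trans e (cong (λ k → k * m + toℕ v) (sym eq))))

_≟ℓ_ : (p q : Letter) → Dec (p ≡ q)
a ≟ℓ a = yes refl
a ≟ℓ b = no λ ()
a ≟ℓ c = no λ ()
b ≟ℓ a = no λ ()
b ≟ℓ b = yes refl
b ≟ℓ c = no λ ()
c ≟ℓ a = no λ ()
c ≟ℓ b = no λ ()
c ≟ℓ c = yes refl

cyclicP-irrefl : ∀ p → cyclicP p p ≡ false
cyclicP-irrefl a = refl
cyclicP-irrefl b = refl
cyclicP-irrefl c = refl

cyclicP-tournament : ∀ {p q} → p ≢ q → cyclicP q p ≡ not (cyclicP p q)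
cyclicP-tournament {a} {a} p≢q = ⊥-elim (p≢q refl)
cyclicP-tournament {b} {b} p≢q = ⊥-elim (p≢q refl)
cyclicP-tournament {c} {c} p≢q = ⊥-elim (p≢q refl)
cyclicP-tournament {a} {b} _ = refl
cyclicP-tournament {a} {c} _ = refl
cyclicP-tournament {b} {a} _ = refl
cyclicP-tournament {b} {c} _ = refl
cyclicP-tournament {c} {a} _ = refl
cyclicP-tournament {c} {b} _ = refl

cyclicP-asym : ∀ {p q} → cyclicP p q ≡ true → cyclicP q p ≡ false
cyclicP-asym {p} {q} pq = trans (cyclicP-tournament p≢q) (cong not pq)
  where
  p≢q : p ≢ q
  p≢q refl = contradiction (trans (sym pq) (cyclicP-irrefl p)) λ ()

letterAdj-< : ∀ {Σ' : Set} {n} (P : Decoder Σ') (w : Vec Σ' n) {i j : Fin n} →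
              toℕ i < toℕ j → letterAdj P w i j ≡ P (lookup w i) (lookup w j)
letterAdj-< P w {i} {j} lt with <-cmp (toℕ i) (toℕ j)
... | tri< _ _ _  = refl
... | tri≈ ¬lt _ _ = contradiction lt ¬lt
... | tri> ¬lt _ _ = contradiction lt ¬lt

record Layout {Σ' : Set} (P : Decoder Σ') {m} (G : Graph m) : Set where
  field
    label           : Fin m → Σ'
    place           : Fin m → ℕ
    place-injective : ∀ {u v} → place u ≡ place v → u ≡ v
    adj-placed      : ∀ u v → place u < place v → adj G u v ≡ P (label u) (label v)

layoutOfIso : ∀ {Σ' : Set} {P : Decoder Σ'} {m n} {G : Graph m} {w : Vec Σ' n} →
              G ≅ letterGraph P w → Layout P G
layoutOfIso {P = P} {G = G} {w = w} (f , iso) = record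
  { label           = lookup w ∘ to
  ; place           = toℕ ∘ to
  ; place-injective = Injection.injective (↔⇒↣ f) ∘ toℕ-injective
  ; adj-placed      = λ u v lt → trans (iso u v) (letterAdj-< P w lt)
  }
  where open Inverse f using (to)

-- A graph with a layout is isomorphic to the letter graph of the word read in placement order:
-- the vertex of rank j carries the j-th letter.
isoOfLayout : ∀ {Σ' : Set} {P : Decoder Σ'} {m} {G : Graph m} →
              Layout P G → Σ (Vec Σ' m) λ w → G ≅ letterGraph P w
isoOfLayout {P = P} {m} {G} L = word , ranking , adj-rank
  where
  open Layout L
  open Ranking place place-injective

  word : Vec _ m
  word = tabulate (label ∘ unrank)

  H : Graph m
  H = letterGraph P word

  lookup-word : ∀ v → lookup word (rank v) ≡ label v
  lookup-word v = trans (lookup∘tabulate _ (rank v)) (cong label (unrank-rank v))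

  adj-before : ∀ u v → place u < place v → adj G u v ≡ adj H (rank u) (rank v)
  adj-before u v lt = begin
    adj G u v                                       ≡⟨ adj-placed u v lt ⟩
    P (label u) (label v)                           ≡⟨ sym (cong₂ P (lookup-word u) (lookup-word v)) ⟩
    P (lookup word (rank u)) (lookup word (rank v)) ≡⟨ sym (letterAdj-< P word (rank-mono lt)) ⟩
    adj H (rank u) (rank v)                         ∎
    where open ≡-Reasoning

  adj-rank : ∀ u v → adj G u v ≡ adj H (rank u) (rank v)
  adj-rank u v with order place place-injective u v
  ... | before lt = adj-before u v lt
  ... | same refl = trans (adj-irr G u) (sym (adj-irr H (rank u)))
  ... | after gt  = trans (adj-sym G u v) (trans (adj-before v u gt) (adj-sym H (rank v) (rank u)))

module Adjacency {m} (G : Graph m) where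
  flip-adj : ∀ {u v e} → adj G u v ≡ e → adj G v u ≡ e
  flip-adj {u} {v} uv = trans (adj-sym G v u) uv

ClassUnion : ∀ {m} (G : Graph m) → (Fin m → Letter) → Letter → Letter → Fin m → Set
ClassUnion G label X Y = _∪_ G (Class G label X) (Class G label Y)

-- If vertices with the same label are never adjacent, the union of any two label classes induces
-- a bipartite graph: colour a vertex by whether it lies in the first class.
classUnion-bipartite : ∀ {m} (G : Graph m) (label : Fin m → Letter) →
  (∀ {u v} → label u ≡ label v → adj G u v ≡ false) →
  ∀ X Y → InducedBipartite G (ClassUnion G label X Y)
classUnion-bipartite G label sameLetter X Y = colour , properly-coloured
  where
  colour : Fin _ → Bool
  colour u = does (label u ≟ℓ X)

  sameColour⇒sameLabel : ∀ {u v} → ClassUnion G label X Y u → ClassUnion G label X Y v →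
                         colour u ≡ colour v → label u ≡ label v
  sameColour⇒sameLabel (inj₁ uX) (inj₁ vX) _ = trans uX (sym vX)
  sameColour⇒sameLabel (inj₂ uY) (inj₂ vY) _ = trans uY (sym vY)
  sameColour⇒sameLabel {u} {v} (inj₁ uX) (inj₂ _) eq =
    trans uX (sym (witness (label v ≟ℓ X) (trans (sym eq) (dec-true (label u ≟ℓ X) uX))))
  sameColour⇒sameLabel {u} {v} (inj₂ _) (inj₁ vX) eq =
    trans (witness (label u ≟ℓ X) (trans eq (dec-true (label v ≟ℓ X) vX))) (sym vX)

  properly-coloured : ∀ u v → ClassUnion G label X Y u → ClassUnion G label X Y v →
                      adj G u v ≡ true → colour u ≢ colour v
  properly-coloured u v su sv uv eq =
    contradiction (trans (sym uv) (sameLetter (sameColour⇒sameLabel su sv eq))) λ ()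

swap-2K2Free : ∀ {m} (G : Graph m) {S T : Fin m → Set} →
  Induced2K2Free G (_∪_ G S T) → Induced2K2Free G (_∪_ G T S)
swap-2K2Free G free u₁ v₁ u₂ v₂ s₁ t₁ s₂ t₂ = free u₁ v₁ u₂ v₂ (swap s₁) (swap t₁) (swap s₂) (swap t₂)

-- The letter classes of a layout for the cyclic decoder form a nice partition: each violation
-- of niceness would give a cycle in the placement order.
module LayoutIsNice {m} {G : Graph m} (L : Layout cyclicP G) where
  open Layout L
  open Adjacency G

  sameLetter-nonadjacent : ∀ {u v} → label u ≡ label v → adj G u v ≡ false
  sameLetter-nonadjacent {u} {v} e with order place place-injective u v
  ... | before lt = trans (adj-placed u v lt) (trans (cong (cyclicP (label u)) (sym e)) (cyclicP-irrefl _))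
  ... | same refl = adj-irr G u
  ... | after gt  = flip-adj (trans (adj-placed v u gt) (trans (cong (cyclicP (label v)) e) (cyclicP-irrefl _)))

  edge-forward : ∀ {u v p q} → label u ≡ p → label v ≡ q → cyclicP p q ≡ true →
                 adj G u v ≡ true → place u < place v
  edge-forward {u} {v} up vq pq uv = compared (order place place-injective u v)
    where
    compared : Order place u v → place u < place v
    compared (before lt) = lt
    compared (same refl) = contradiction (trans (sym uv) (adj-irr G u)) λ ()
    compared (after gt)  = contradiction (trans (sym uv) (flip-adj (trans (adj-placed v u gt) vu∉P))) λ ()
      where
      vu∉P : cyclicP (label v) (label u) ≡ false
      vu∉P = cyclicP-asym (trans (cong₂ cyclicP up vq) pq)

  nonedge-backward : ∀ {u v p q} → label u ≡ p → label v ≡ q → cyclicP p q ≡ true →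
                     adj G u v ≡ false → place v < place u
  nonedge-backward {u} {v} up vq pq uv = compared (order place place-injective u v)
    where
    uv∈P : cyclicP (label u) (label v) ≡ true
    uv∈P = trans (cong₂ cyclicP up vq) pq
    compared : Order place u v → place v < place u
    compared (before lt) = contradiction (trans (sym uv∈P) (trans (sym (adj-placed u v lt)) uv)) λ ()
    compared (same refl) = contradiction (trans (sym uv∈P) (cyclicP-irrefl (label u))) λ ()
    compared (after gt)  = gt

  independent : ∀ ℓ → Independent G (Class G label ℓ)
  independent ℓ u v uℓ vℓ = sameLetter-nonadjacent (trans uℓ (sym vℓ))

  -- In G[X ∪ Y] with (X, Y) ∈ P, edges x₁y₁ and x₂y₂ from X to Y with non-adjacent cross pairs
  -- would give place x₁ < place y₁ < place x₂ < place y₂ < place x₁.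
  module _ {X Y : Letter} (XY∈P : cyclicP X Y ≡ true) where

    noCrossed2K2 : ∀ {x₁ y₁ x₂ y₂} → label x₁ ≡ X → label y₁ ≡ Y → label x₂ ≡ X → label y₂ ≡ Y →
      adj G x₁ y₁ ≡ true → adj G x₂ y₂ ≡ true → adj G x₁ y₂ ≡ false → adj G x₂ y₁ ≡ false → ⊥
    noCrossed2K2 x₁X y₁Y x₂X y₂Y e₁ e₂ n₁₂ n₂₁ =
      <-irrefl refl (<-trans (<-trans (<-trans (edge-forward x₁X y₁Y XY∈P e₁)
                                               (nonedge-backward x₂X y₁Y XY∈P n₂₁))
                                      (edge-forward x₂X y₂Y XY∈P e₂))
                             (nonedge-backward x₁X y₂Y XY∈P n₁₂))

    edge-ends : ∀ {u v} → ClassUnion G label X Y u → ClassUnion G label X Y v → adj G u v ≡ true →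
                (label u ≡ X × label v ≡ Y) ⊎ (label u ≡ Y × label v ≡ X)
    edge-ends (inj₁ uX) (inj₂ vY) _ = inj₁ (uX , vY)
    edge-ends (inj₂ uY) (inj₁ vX) _ = inj₂ (uY , vX)
    edge-ends (inj₁ uX) (inj₁ vX) uv = contradiction (trans (sym uv) (independent X _ _ uX vX)) λ ()
    edge-ends (inj₂ uY) (inj₂ vY) uv = contradiction (trans (sym uv) (independent Y _ _ uY vY)) λ ()

    classUnion-2K2Free : Induced2K2Free G (ClassUnion G label X Y)
    classUnion-2K2Free u₁ v₁ u₂ v₂ s₁ t₁ s₂ t₂ (e₁ , e₂ , nu₁u₂ , nu₁v₂ , nv₁u₂ , nv₁v₂)
      with edge-ends s₁ t₁ e₁ | edge-ends s₂ t₂ e₂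
    ... | inj₁ (u₁X , v₁Y) | inj₁ (u₂X , v₂Y) = noCrossed2K2 u₁X v₁Y u₂X v₂Y e₁ e₂ nu₁v₂ (flip-adj nv₁u₂)
    ... | inj₁ (u₁X , v₁Y) | inj₂ (u₂Y , v₂X) = noCrossed2K2 u₁X v₁Y v₂X u₂Y e₁ (flip-adj e₂) nu₁u₂ (flip-adj nv₁v₂)
    ... | inj₂ (u₁Y , v₁X) | inj₁ (u₂X , v₂Y) = noCrossed2K2 v₁X u₁Y u₂X v₂Y (flip-adj e₁) e₂ nv₁v₂ (flip-adj nu₁u₂)
    ... | inj₂ (u₁Y , v₁X) | inj₂ (u₂Y , v₂X) = noCrossed2K2 v₁X u₁Y v₂X u₂Y (flip-adj e₁) (flip-adj e₂) nv₁u₂ (flip-adj nu₁v₂)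

  nice : NicePartition G label
  nice = record
    { indA = independent a ; indB = independent b ; indC = independent c
    ; bipAB = bipartite a b ; bipBC = bipartite b c ; bipCA = bipartite c a
    ; freeAB = classUnion-2K2Free refl ; freeBC = classUnion-2K2Free refl ; freeCA = classUnion-2K2Free refl
    ; noTriangle = λ { x y z xA yB zC (xy , yz , xz) →
        <-irrefl refl (<-trans (<-trans (edge-forward xA yB refl xy) (edge-forward yB zC refl yz))
                               (edge-forward zC xA refl (flip-adj xz))) }
    ; noIndep3 = λ { x y z xA yB zC (xy , yz , xz) →
        <-irrefl refl (<-trans (<-trans (nonedge-backward zC xA refl (flip-adj xz))
                                        (nonedge-backward yB zC refl yz))
                               (nonedge-backward xA yB refl xy)) }
    }
    where
    bipartite : ∀ X Y → InducedBipartite G (ClassUnion G label X Y)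
    bipartite = classUnion-bipartite G label sameLetter-nonadjacent

module NiceHasLayout {m} (G : Graph m) (label : Fin m → Letter) (np : NicePartition G label) where
  open NicePartition np
  open Adjacency G

  independent : ∀ ℓ → Independent G (Class G label ℓ)
  independent a = indA
  independent b = indB
  independent c = indC

  sameLetter-nonadjacent : ∀ {u v} → label u ≡ label v → adj G u v ≡ false
  sameLetter-nonadjacent {u} {v} e = independent (label v) u v e refl

  -- Forced u v: u and v have distinct letters and their adjacency is the one P prescribes for
  -- u placed before v; so any layout with these letters must place u before v.
  Forced : Fin m → Fin m → Set
  Forced u v = label u ≢ label v × adj G u v ≡ cyclicP (label u) (label v)

  forced? : ∀ u v → Dec (Forced u v)
  forced? u v = ¬? (label u ≟ℓ label v) ×-dec (adj G u v ≟ᵇ cyclicP (label u) (label v))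

  forced-at : ∀ {u v p q} → Forced u v → label u ≡ p → label v ≡ q → adj G u v ≡ cyclicP p q
  forced-at (_ , uv) up vq = trans uv (cong₂ cyclicP up vq)

  forced-total : ∀ {u v} → label u ≢ label v → Forced u v ⊎ Forced v u
  forced-total {u} {v} u≢v with adj G u v ≟ᵇ cyclicP (label u) (label v)
  ... | yes uv = inj₁ (u≢v , uv)
  ... | no ¬uv = inj₂ (u≢v ∘ sym , flip-adj (trans (¬-not ¬uv) (sym (cyclicP-tournament u≢v))))

  forced-asym : ∀ {u v} → Forced u v → Forced v u → ⊥
  forced-asym {u} {v} (u≢v , uv) (_ , vu) =
    not-¬ refl (trans (sym uv) (trans (flip-adj vu) (cyclicP-tournament u≢v)))

  adj-unless-forced : ∀ {u v} → ¬ Forced v u → adj G u v ≡ cyclicP (label u) (label v)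
  adj-unless-forced {u} {v} ¬vu with label u ≟ℓ label v
  ... | yes e  = trans (sameLetter-nonadjacent e)
                       (sym (trans (cong (cyclicP (label u)) (sym e)) (cyclicP-irrefl (label u))))
  ... | no u≢v = [ proj₂ , (λ vu → contradiction vu ¬vu) ] (forced-total u≢v)

  classUnion-2K2Free : ∀ {p q} → p ≢ q → Induced2K2Free G (ClassUnion G label p q)
  classUnion-2K2Free {a} {b} _ = freeAB
  classUnion-2K2Free {b} {c} _ = freeBC
  classUnion-2K2Free {c} {a} _ = freeCA
  classUnion-2K2Free {b} {a} _ = swap-2K2Free G freeAB
  classUnion-2K2Free {c} {b} _ = swap-2K2Free G freeBC
  classUnion-2K2Free {a} {c} _ = swap-2K2Free G freeCA
  classUnion-2K2Free {a} {a} p≢q = ⊥-elim (p≢q refl)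
  classUnion-2K2Free {b} {b} p≢q = ⊥-elim (p≢q refl)
  classUnion-2K2Free {c} {c} p≢q = ⊥-elim (p≢q refl)

  noCrossed2K2 : ∀ {p q x₁ y₁ x₂ y₂} → p ≢ q →
    label x₁ ≡ p → label y₁ ≡ q → label x₂ ≡ p → label y₂ ≡ q →
    adj G x₁ y₁ ≡ true → adj G x₂ y₂ ≡ true → adj G x₁ y₂ ≡ false → adj G x₂ y₁ ≡ false → ⊥
  noCrossed2K2 {x₁ = x₁} {y₁} {x₂} {y₂} p≢q x₁p y₁q x₂p y₂q e₁ e₂ n₁₂ n₂₁ =
    classUnion-2K2Free p≢q x₁ y₁ x₂ y₂ (inj₁ x₁p) (inj₂ y₁q) (inj₁ x₂p) (inj₂ y₂q)
      ( e₁ , e₂ , sameLetter-nonadjacent (trans x₁p (sym x₂p)) , n₁₂ , flip-adj n₂₁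
      , sameLetter-nonadjacent (trans y₁q (sym y₂q)) )

  noMonochromaticRainbow : ∀ e {x y z} → label x ≡ a → label y ≡ b → label z ≡ c →
    adj G x y ≡ e → adj G y z ≡ e → adj G z x ≡ e → ⊥
  noMonochromaticRainbow true  xA yB zC xy yz zx = noTriangle _ _ _ xA yB zC (xy , yz , flip-adj zx)
  noMonochromaticRainbow false xA yB zC xy yz zx = noIndep3 _ _ _ xA yB zC (xy , yz , flip-adj zx)

  -- no directed triangle of forced orders: its letters would be a rotation of (a, b, c), making it
  -- a triangle, or of (a, c, b), making it independent
  noForcedTriangle : ∀ {x y z} → Forced x y → Forced y z → Forced z x → ⊥
  noForcedTriangle {x} {y} {z} xy yz zx = byLetters (label x) (label y) (label z) refl refl refl
    where
    byLetters : ∀ p q r → label x ≡ p → label y ≡ q → label z ≡ r → ⊥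
    byLetters a b c ex ey ez =
      noMonochromaticRainbow true ex ey ez (forced-at xy ex ey) (forced-at yz ey ez) (forced-at zx ez ex)
    byLetters b c a ex ey ez =
      noMonochromaticRainbow true ez ex ey (forced-at zx ez ex) (forced-at xy ex ey) (forced-at yz ey ez)
    byLetters c a b ex ey ez =
      noMonochromaticRainbow true ey ez ex (forced-at yz ey ez) (forced-at zx ez ex) (forced-at xy ex ey)
    byLetters a c b ex ey ez = noMonochromaticRainbow false ex ez ey
      (flip-adj (forced-at zx ez ex)) (flip-adj (forced-at yz ey ez)) (flip-adj (forced-at xy ex ey))
    byLetters c b a ex ey ez = noMonochromaticRainbow false ez ey ex
      (flip-adj (forced-at yz ey ez)) (flip-adj (forced-at xy ex ey)) (flip-adj (forced-at zx ez ex))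
    byLetters b a c ex ey ez = noMonochromaticRainbow false ey ex ez
      (flip-adj (forced-at xy ex ey)) (flip-adj (forced-at zx ez ex)) (flip-adj (forced-at yz ey ez))
    byLetters a a _ ex ey _  = proj₁ xy (trans ex (sym ey))
    byLetters b b _ ex ey _  = proj₁ xy (trans ex (sym ey))
    byLetters c c _ ex ey _  = proj₁ xy (trans ex (sym ey))
    byLetters _ a a _ ey ez  = proj₁ yz (trans ey (sym ez))
    byLetters _ b b _ ey ez  = proj₁ yz (trans ey (sym ez))
    byLetters _ c c _ ey ez  = proj₁ yz (trans ey (sym ez))
    byLetters a _ a ex _ ez  = proj₁ zx (trans ez (sym ex))
    byLetters b _ b ex _ ez  = proj₁ zx (trans ez (sym ex))
    byLetters c _ c ex _ ez  = proj₁ zx (trans ez (sym ex))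

  -- no directed square x → y → z → t → x of forced orders alternating between two classes:
  -- its edges would be xy, zt or yz, tx, a 2K₂ between the two classes
  noForcedSquare : ∀ {x y z t} → label z ≡ label x → label t ≡ label y →
    Forced x y → Forced y z → Forced z t → Forced t x → ⊥
  noForcedSquare {x} {y} {z} {t} zx ty xy yz zt tx =
    alternating (cyclicP (label x) (label y))
      (forced-at xy refl refl) (trans (forced-at yz refl zx) qp) (forced-at zt zx ty) (trans (forced-at tx ty refl) qp)
    where
    p≢q : label x ≢ label y
    p≢q = proj₁ xy
    qp : cyclicP (label y) (label x) ≡ not (cyclicP (label x) (label y))
    qp = cyclicP-tournament p≢q
    alternating : ∀ e → adj G x y ≡ e → adj G y z ≡ not e → adj G z t ≡ e → adj G t x ≡ not e → ⊥
    alternating true  exy eyz ezt etx = noCrossed2K2 p≢q refl refl zx ty exy ezt (flip-adj etx) (flip-adj eyz)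
    alternating false exy eyz ezt etx = noCrossed2K2 (p≢q ∘ sym) refl zx ty refl eyz etx (flip-adj exy) (flip-adj ezt)

  Reach : Fin m → Fin m → Set
  Reach u v = Forced u v ⊎ ∃ λ w → Forced u w × Forced w v

  reach? : ∀ u v → Dec (Reach u v)
  reach? u v = forced? u v ⊎-dec any? (λ w → forced? u w ×-dec forced? w v)

  -- Every forced path x → w → u → v has a shortcut of length at most two: comparing x with u,
  -- and then w with v, either gives the shortcut or closes a forbidden triangle or square.
  shortcut : ∀ {x w u v} → Forced x w → Forced w u → Forced u v → Reach x v
  shortcut {x} {w} {u} {v} xw wu uv with label x ≟ℓ label u
  ... | no x≢u = [ (λ xu → inj₂ (u , xu , uv)) , (λ ux → ⊥-elim (noForcedTriangle xw wu ux)) ] (forced-total x≢u)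
  ... | yes x≡u with label w ≟ℓ label v
  ...   | no w≢v = [ (λ wv → inj₂ (w , xw , wv)) , (λ vw → ⊥-elim (noForcedTriangle wu uv vw)) ] (forced-total w≢v)
  ...   | yes w≡v = [ inj₁ , (λ vx → ⊥-elim (noForcedSquare (sym x≡u) (sym w≡v) xw wu uv vx)) ]
                      (forced-total (λ x≡v → proj₁ uv (trans (sym x≡u) x≡v)))

  reach-extend : ∀ {x u v} → Reach x u → Forced u v → Reach x v
  reach-extend (inj₁ xu) uv = inj₂ (_ , xu , uv)
  reach-extend (inj₂ (w , xw , wu)) uv = shortcut xw wu uv

  reach-trans : ∀ {x u v} → Reach x u → Reach u v → Reach x v
  reach-trans xu (inj₁ uv) = reach-extend xu uv
  reach-trans xu (inj₂ (w , uw , wv)) = reach-extend (reach-extend xu uw) wv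

  reach-irrefl : ∀ x → ¬ Reach x x
  reach-irrefl x (inj₁ xx) = proj₁ xx refl
  reach-irrefl x (inj₂ (w , xw , wx)) = forced-asym xw wx

  open Height reach? reach-irrefl reach-trans using (height; height-mono)
  open TieBreak height using (key; key-mono; key-injective)

  layout : Layout cyclicP G
  layout = record
    { label           = label
    ; place           = key
    ; place-injective = key-injective
    ; adj-placed      = λ u v lt → adj-unless-forced (λ vu → <-asym lt (key-mono (height-mono (inj₁ vu))))
    }

theorem5 : ∀ {m} (G : Graph m) →
    (Σ ℕ λ n → Σ (Vec Letter n) λ w → G ≅ letterGraph cyclicP w) ⇔ Nice G
theorem5 {m} G = mk⇔ letterGraph⇒nice nice⇒letterGraph
  where
  letterGraph⇒nice : (Σ ℕ λ n → Σ (Vec Letter n) λ w → G ≅ letterGraph cyclicP w) → Nice G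
  letterGraph⇒nice (_ , _ , iso) = Layout.label layout , LayoutIsNice.nice layout
    where
    layout : Layout cyclicP G
    layout = layoutOfIso iso

  nice⇒letterGraph : Nice G → Σ ℕ λ n → Σ (Vec Letter n) λ w → G ≅ letterGraph cyclicP w
  nice⇒letterGraph (label , np) = m , isoOfLayout (NiceHasLayout.layout G label np)
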